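{- Let $G=(V,E)$ be a finite, connected, simple graph with $n=|V|$ and diameter $\delta=\mathrm{diam}(G)$, and let $k>0$ be an integer. Then $\beta_k(G)\le \beta_k(P_{\delta+1})+(n-(\delta+1))$, where $P_{\delta+1}$ is the path on $\delta+1$ vertices.
   Context: For a graph $G=(V,E)$ with geodesic (shortest-path) distance $d$, and an integer $k\ge 0$, define $d_k(u,v):=\min\{d(u,v),k+1\}$. A non-empty set $R\subseteq V$ is a $k$-truncated resolving set of $G$ if for all $u,v\in V$, $d_k(u,r)=d_k(v,r)$ for every $r\in R$ implies $u=v$. The $k$-truncated metric dimension $\beta_k(G)$ is the minimum size of a $k$-truncated resolving set of $G$. -}

module Defs where

open import Data.Nat using (ℕ; zero; suc; _≤_; _⊓_; _≡ᵇ_)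
open import Data.Bool using (Bool; T; _∨_)
open import Data.Fin using (Fin; toℕ)
open import Data.Fin.Subset using (Subset; _∈_; Nonempty; ∣_∣)
open import Data.Product using (Σ; _×_; ∃)
open import Relation.Binary.PropositionalEquality using (_≡_)
open import Relation.Nullary using (¬_)

Adj : ℕ → Set
Adj n = Fin n → Fin n → Bool

Symmetric : ∀ {n} → Adj n → Set
Symmetric {n} A = ∀ (u v : Fin n) → A u v ≡ A v u

Loopless : ∀ {n} → Adj n → Set
Loopless {n} A = ∀ (u : Fin n) → ¬ T (A u u)

data Walk {n : ℕ} (A : Adj n) : Fin n → Fin n → ℕ → Set where
  here : ∀ {u} → Walk A u u zero
  step : ∀ {u v w l} → T (A u v) → Walk A v w l → Walk A u w (suc l)

Connected : ∀ {n} → Adj n → Set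
Connected {n} A = ∀ (u v : Fin n) → ∃ λ l → Walk A u v l

Dist : ∀ {n} → Adj n → Fin n → Fin n → ℕ → Set
Dist A u v d = Walk A u v d × (∀ l → Walk A u v l → d ≤ l)

Diameter : ∀ {n} → Adj n → ℕ → Set
Diameter {n} A δ =
  (∀ (u v : Fin n) d → Dist A u v d → d ≤ δ) ×
  Σ (Fin n) λ u → Σ (Fin n) λ v → Dist A u v δ

truncate : ℕ → ℕ → ℕ
truncate k d = d ⊓ suc k

TruncResolving : ∀ {n} → Adj n → ℕ → Subset n → Set
TruncResolving {n} A k R =
  Nonempty R ×
  (∀ (u v : Fin n) →
     (∀ r → r ∈ R → ∀ du dv → Dist A u r du → Dist A v r dv →
        truncate k du ≡ truncate k dv) →
     u ≡ v)

IsTruncMetDim : ∀ {n} → Adj n → ℕ → ℕ → Set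
IsTruncMetDim {n} A k b =
  (Σ (Subset n) λ R → TruncResolving A k R × ∣ R ∣ ≡ b) ×
  (∀ (R : Subset n) → TruncResolving A k R → b ≤ ∣ R ∣)

pathAdj : (m : ℕ) → Adj m
pathAdj m i j = (toℕ i ≡ᵇ suc (toℕ j)) ∨ (toℕ j ≡ᵇ suc (toℕ i))

-- A geodesic realising the diameter δ is an isometric copy of the path P_{δ+1} in G.
-- Transport an optimal k-truncated resolving set of the path onto this copy and add
-- every vertex off the geodesic. A vertex r of the new set is separated from every
-- other vertex by r itself (truncated distance 0 versus a positive one), and two
-- vertices of the geodesic are separated by the transported set because the embedding
-- preserves distances.
module Submission where

open import Defs
open import Data.Nat using (ℕ; zero; suc; _≤_; _<_; _+_; _∸_; z≤n; s≤s; ∣_-_∣; _≡ᵇ_)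
open import Data.Nat.Properties hiding (suc-injective; _≟_)
open import Data.Nat.Induction using (<-wellFounded)
open import Data.Bool using (T)
open import Data.Bool.Properties using (T-∨; ∨-comm)
open import Data.Fin using (Fin; zero; suc; toℕ; fromℕ<; _≟_)
open import Data.Fin.Properties using (any?; toℕ-injective; toℕ<n; toℕ-fromℕ<; suc-injective)
open import Data.Fin.Subset
  using (Subset; _∈_; _∉_; ∣_∣; ⊤; ⊥; ⁅_⁆; _∪_; ∁; inside; outside)
open import Data.Fin.Subset.Properties
  using (_∈?_; ∉⊥; x∈⁅x⁆; x∈⁅y⁆⇒x≡y; x∈p∪q⁺; x∈p∪q⁻; ∪-identityˡ; x∉p⇒x∈∁p; ∣∁p∣≡n∸∣p∣; ∣⊤∣≡n; ∣⊥∣≡0)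
open import Data.Vec using (_∷_; []; here; there)
open import Data.Product using (∃; _,_; proj₁; proj₂)
open import Data.Sum using (inj₁; inj₂)
open import Data.Empty using (⊥-elim)
open import Function using (_∘_)
open import Function.Bundles using (Equivalence)
open import Function.Definitions using (Injective)
open import Induction.WellFounded using (Acc; acc)
open import Relation.Binary.PropositionalEquality
open import Relation.Nullary using (Dec; yes; no)
open import Relation.Nullary.Decidable using (_×-dec_)
open import Relation.Nullary.Decidable.Core using (T?)

image : ∀ {m n} → (Fin m → Fin n) → Subset m → Subset n
image f []            = ⊥
image f (inside ∷ S)  = ⁅ f zero ⁆ ∪ image (f ∘ suc) S
image f (outside ∷ S) = image (f ∘ suc) S

f∈image : ∀ {m n} (f : Fin m → Fin n) {S i} → i ∈ S → f i ∈ image f S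
f∈image f {inside ∷ S}  here        = x∈p∪q⁺ (inj₁ (x∈⁅x⁆ (f zero)))
f∈image f {inside ∷ S}  (there i∈S) = x∈p∪q⁺ (inj₂ (f∈image (f ∘ suc) i∈S))
f∈image f {outside ∷ S} (there i∈S) = f∈image (f ∘ suc) i∈S

∈image⇒ : ∀ {m n} (f : Fin m → Fin n) S {y} → y ∈ image f S → ∃ λ i → f i ≡ y
∈image⇒ f []            y∈ = ⊥-elim (∉⊥ y∈)
∈image⇒ f (inside ∷ S)  y∈ with x∈p∪q⁻ ⁅ f zero ⁆ (image (f ∘ suc) S) y∈
... | inj₁ y∈⁅f0⁆ = zero , sym (x∈⁅y⁆⇒x≡y (f zero) y∈⁅f0⁆)
... | inj₂ y∈rest = let i , fi≡y = ∈image⇒ (f ∘ suc) S y∈rest in suc i , fi≡y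
∈image⇒ f (outside ∷ S) y∈ = let i , fi≡y = ∈image⇒ (f ∘ suc) S y∈ in suc i , fi≡y

∣p∪q∣≤∣p∣+∣q∣ : ∀ {n} (p q : Subset n) → ∣ p ∪ q ∣ ≤ ∣ p ∣ + ∣ q ∣
∣p∪q∣≤∣p∣+∣q∣ []            []            = z≤n
∣p∪q∣≤∣p∣+∣q∣ (inside ∷ p)  (inside ∷ q)  = s≤s (≤-trans (∣p∪q∣≤∣p∣+∣q∣ p q) (+-monoʳ-≤ ∣ p ∣ (n≤1+n ∣ q ∣)))
∣p∪q∣≤∣p∣+∣q∣ (inside ∷ p)  (outside ∷ q) = s≤s (∣p∪q∣≤∣p∣+∣q∣ p q)
∣p∪q∣≤∣p∣+∣q∣ (outside ∷ p) (inside ∷ q)  = subst (suc ∣ p ∪ q ∣ ≤_) (sym (+-suc ∣ p ∣ ∣ q ∣)) (s≤s (∣p∪q∣≤∣p∣+∣q∣ p q))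
∣p∪q∣≤∣p∣+∣q∣ (outside ∷ p) (outside ∷ q) = ∣p∪q∣≤∣p∣+∣q∣ p q

x∉p⇒∣⁅x⁆∪p∣≡1+∣p∣ : ∀ {n} (x : Fin n) (p : Subset n) → x ∉ p → ∣ ⁅ x ⁆ ∪ p ∣ ≡ suc ∣ p ∣
x∉p⇒∣⁅x⁆∪p∣≡1+∣p∣ zero    (inside ∷ p)  x∉p = ⊥-elim (x∉p here)
x∉p⇒∣⁅x⁆∪p∣≡1+∣p∣ zero    (outside ∷ p) x∉p = cong (suc ∘ ∣_∣) (∪-identityˡ p)
x∉p⇒∣⁅x⁆∪p∣≡1+∣p∣ (suc x) (inside ∷ p)  x∉p = cong suc (x∉p⇒∣⁅x⁆∪p∣≡1+∣p∣ x p (x∉p ∘ there))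
x∉p⇒∣⁅x⁆∪p∣≡1+∣p∣ (suc x) (outside ∷ p) x∉p = x∉p⇒∣⁅x⁆∪p∣≡1+∣p∣ x p (x∉p ∘ there)

∣image∣≡∣S∣ : ∀ {m n} {f : Fin m → Fin n} → Injective _≡_ _≡_ f → ∀ S → ∣ image f S ∣ ≡ ∣ S ∣
∣image∣≡∣S∣ {n = n} inj []            = ∣⊥∣≡0 n
∣image∣≡∣S∣ {f = f} inj (inside ∷ S)  = begin
  ∣ ⁅ f zero ⁆ ∪ image (f ∘ suc) S ∣  ≡⟨ x∉p⇒∣⁅x⁆∪p∣≡1+∣p∣ (f zero) _ f0∉image ⟩
  suc ∣ image (f ∘ suc) S ∣           ≡⟨ cong suc (∣image∣≡∣S∣ (suc-injective ∘ inj) S) ⟩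
  suc ∣ S ∣                           ∎
  where
  open ≡-Reasoning
  f0∉image : f zero ∉ image (f ∘ suc) S
  f0∉image f0∈ with ∈image⇒ (f ∘ suc) S f0∈
  ... | i , fi≡f0 with inj fi≡f0
  ... | ()
∣image∣≡∣S∣         inj (outside ∷ S) = ∣image∣≡∣S∣ (suc-injective ∘ inj) S

truncate-reflects-0 : ∀ k d → truncate k 0 ≡ truncate k d → d ≡ 0
truncate-reflects-0 k zero    _  = refl
truncate-reflects-0 k (suc d) ()

module _ {n : ℕ} (A : Adj n) where

  _++ʷ_ : ∀ {u v w a b} → Walk A u v a → Walk A v w b → Walk A u w (a + b)
  here      ++ʷ Y = Y
  step uv X ++ʷ Y = step uv (X ++ʷ Y)

  _∷ʳ_ : ∀ {u v w l} → Walk A u v l → T (A v w) → Walk A u w (suc l)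
  here      ∷ʳ vw = step vw here
  step uv X ∷ʳ vw = step uv (X ∷ʳ vw)

  reverse : Symmetric A → ∀ {u w l} → Walk A u w l → Walk A w u l
  reverse sym-A here                    = here
  reverse sym-A {u} (step {v = v} uv X) = reverse sym-A X ∷ʳ subst T (sym-A u v) uv

  length-zero-walk : ∀ {u v} → Walk A u v 0 → u ≡ v
  length-zero-walk here = refl

  dist-refl : ∀ u → Dist A u u 0
  dist-refl u = here , λ _ _ → z≤n

  dist-unique : ∀ {u v d d′} → Dist A u v d → Dist A u v d′ → d ≡ d′
  dist-unique (X , X-shortest) (Y , Y-shortest) = ≤-antisym (X-shortest _ Y) (Y-shortest _ X)

  dist-sym : Symmetric A → ∀ {u v d} → Dist A u v d → Dist A v u d
  dist-sym sym-A (X , X-shortest) = reverse sym-A X , λ l Y → X-shortest l (reverse sym-A Y)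

  walk? : ∀ u w l → Dec (Walk A u w l)
  walk? u w zero with u ≟ w
  ... | yes refl = yes here
  ... | no u≢w   = no λ { here → u≢w refl }
  walk? u w (suc l) with any? (λ v → T? (A u v) ×-dec walk? v w l)
  ... | yes (v , uv , X) = yes (step uv X)
  ... | no none          = no λ { (step uv X) → none (_ , uv , X) }

  shortest : ∀ {u w l} → Acc _<_ l → Walk A u w l → ∃ (Dist A u w)
  shortest {u} {w} {l} (acc rec) X with any? (λ (i : Fin l) → walk? u w (toℕ i))
  ... | yes (i , Y) = shortest (rec (toℕ<n i)) Y
  ... | no none     = l , X , λ m Y → ≮⇒≥ λ m<l →
    none (fromℕ< m<l , subst (Walk A u w) (sym (toℕ-fromℕ< m<l)) Y)

  dist-exists : Connected A → ∀ u w → ∃ (Dist A u w)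
  dist-exists connected u w = shortest (<-wellFounded _) (proj₂ (connected u w))

  vertexAt : ∀ {u w l} → Walk A u w l → ℕ → Fin n
  vertexAt {u} _          zero    = u
  vertexAt {u} here       (suc i) = u
  vertexAt     (step _ X) (suc i) = vertexAt X i

  vertexAt-end : ∀ {u w l} (X : Walk A u w l) → vertexAt X l ≡ w
  vertexAt-end here       = refl
  vertexAt-end (step _ X) = vertexAt-end X

  subwalk : ∀ {u w l i j} (X : Walk A u w l) → i ≤ j → j ≤ l →
            Walk A (vertexAt X i) (vertexAt X j) (j ∸ i)
  subwalk X           z≤n       z≤n       = here
  subwalk (step uv X) z≤n       (s≤s j≤l) = step uv (subwalk X z≤n j≤l)
  subwalk (step uv X) (s≤s i≤j) (s≤s j≤l) = subwalk X i≤j j≤l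

  geodesic-subwalk-dist : ∀ {u w l i j} (D : Dist A u w l) → i ≤ j → j ≤ l →
                          Dist A (vertexAt (proj₁ D) i) (vertexAt (proj₁ D) j) (j ∸ i)
  geodesic-subwalk-dist {u} {w} {l} {i} {j} (X , X-shortest) i≤j j≤l =
    subwalk X i≤j j≤l , λ m Y → m≤n+o⇒m∸n≤o j i (j≤i+m (X-shortest _ (detour Y)))
    where
    detour : ∀ {m} → Walk A (vertexAt X i) (vertexAt X j) m → Walk A u w (i + (m + (l ∸ j)))
    detour Y = subwalk X z≤n (≤-trans i≤j j≤l)
           ++ʷ (Y ++ʷ subst (λ x → Walk A (vertexAt X j) x (l ∸ j)) (vertexAt-end X) (subwalk X j≤l ≤-refl))
    j≤i+m : ∀ {m} → l ≤ i + (m + (l ∸ j)) → j ≤ i + m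
    j≤i+m {m} l≤ = +-cancelʳ-≤ (l ∸ j) j (i + m) (begin
      j + (l ∸ j)       ≡⟨ m+[n∸m]≡n j≤l ⟩
      l                 ≤⟨ l≤ ⟩
      i + (m + (l ∸ j)) ≡⟨ +-assoc i m (l ∸ j) ⟨
      i + m + (l ∸ j)   ∎)
      where open ≤-Reasoning

  geodesic-dist : Symmetric A → ∀ {u w l} (D : Dist A u w l) (i j : Fin (suc l)) →
                  Dist A (vertexAt (proj₁ D) (toℕ i)) (vertexAt (proj₁ D) (toℕ j)) ∣ toℕ i - toℕ j ∣
  geodesic-dist sym-A D i j with ≤-total (toℕ i) (toℕ j)
  ... | inj₁ i≤j = subst (Dist A _ _) (sym (m≤n⇒∣m-n∣≡n∸m i≤j))
                     (geodesic-subwalk-dist D i≤j (≤-pred (toℕ<n j)))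
  ... | inj₂ j≤i = subst (Dist A _ _) (sym (m≤n⇒∣n-m∣≡n∸m j≤i))
                     (dist-sym sym-A (geodesic-subwalk-dist D j≤i (≤-pred (toℕ<n i))))

SameTruncDistances : ∀ {n} → Adj n → ℕ → Subset n → Fin n → Fin n → Set
SameTruncDistances A k R u v =
  ∀ r → r ∈ R → ∀ du dv → Dist A u r du → Dist A v r dv → truncate k du ≡ truncate k dv

sameTruncDistances-sym : ∀ {n} {A : Adj n} {k R u v} →
                         SameTruncDistances A k R u v → SameTruncDistances A k R v u
sameTruncDistances-sym same r r∈R dv du Dv Du = sym (same r r∈R du dv Du Dv)

landmark-resolves : ∀ {n} {A : Adj n} {k R u v} → Connected A → u ∈ R →
                    SameTruncDistances A k R u v → u ≡ v
landmark-resolves {A = A} {k} {u = u} {v} connected u∈R same =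
  sym (length-zero-walk A (subst (Walk A v u) dv≡0 (proj₁ (proj₂ Dv))))
  where
  Dv = dist-exists A connected v u
  dv≡0 = truncate-reflects-0 k _ (same u u∈R 0 _ (dist-refl A u) (proj₂ Dv))

Isometric : ∀ {m n} → Adj m → Adj n → (Fin m → Fin n) → Set
Isometric B A f = ∀ {i j d} → Dist B i j d → Dist A (f i) (f j) d

isometric-injective : ∀ {m n} {B : Adj m} {A : Adj n} {f} → Connected B → Isometric B A f →
                      Injective _≡_ _≡_ f
isometric-injective {B = B} {A} {f} connected-B iso {i} {j} fi≡fj =
  length-zero-walk B (subst (Walk B i j) d≡0 (proj₁ (proj₂ D)))
  where
  D = dist-exists B connected-B i j
  d≡0 = n≤0⇒n≡0 (proj₂ (iso (proj₂ D)) 0 (subst (λ x → Walk A (f i) x 0) fi≡fj here))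

extension : ∀ {m n} → (Fin m → Fin n) → Subset m → Subset n
extension f S = image f S ∪ ∁ (image f ⊤)

∣extension∣≤ : ∀ {m n} {f : Fin m → Fin n} → Injective _≡_ _≡_ f → ∀ S →
               ∣ extension f S ∣ ≤ ∣ S ∣ + (n ∸ m)
∣extension∣≤ {m} {n} {f} inj S = begin
  ∣ image f S ∪ ∁ (image f ⊤) ∣      ≤⟨ ∣p∪q∣≤∣p∣+∣q∣ (image f S) _ ⟩
  ∣ image f S ∣ + ∣ ∁ (image f ⊤) ∣  ≡⟨ cong₂ _+_ (∣image∣≡∣S∣ inj S) (∣∁p∣≡n∸∣p∣ (image f ⊤)) ⟩
  ∣ S ∣ + (n ∸ ∣ image f ⊤ ∣)        ≡⟨ cong (λ x → ∣ S ∣ + (n ∸ x)) (trans (∣image∣≡∣S∣ inj ⊤) (∣⊤∣≡n m)) ⟩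
  ∣ S ∣ + (n ∸ m)                    ∎
  where open ≤-Reasoning

extension-resolving : ∀ {m n} {B : Adj m} {A : Adj n} {f k S} → Connected A → Isometric B A f →
                      TruncResolving B k S → TruncResolving A k (extension f S)
extension-resolving {A = A} {f} {k} {S} connected iso ((s , s∈S) , resolves) =
  (f s , x∈p∪q⁺ (inj₁ (f∈image f s∈S))) , resolves′
  where
  resolves′ : ∀ u v → SameTruncDistances A k (extension f S) u v → u ≡ v
  resolves′ u v same with u ∈? image f ⊤ | v ∈? image f ⊤
  ... | no u∉ | _    = landmark-resolves connected (x∈p∪q⁺ (inj₂ (x∉p⇒x∈∁p u∉))) same
  ... | yes _ | no v∉ =
    sym (landmark-resolves connected (x∈p∪q⁺ (inj₂ (x∉p⇒x∈∁p v∉))) (sameTruncDistances-sym same))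
  ... | yes u∈ | yes v∈ with ∈image⇒ f ⊤ u∈ | ∈image⇒ f ⊤ v∈
  ... | i , refl | j , refl = cong f (resolves i j λ r r∈S du dv Di Dj →
          same (f r) (x∈p∪q⁺ (inj₁ (f∈image f r∈S))) du dv (iso Di) (iso Dj))

truncMetDim-≤-isometric : ∀ {m n} (B : Adj m) (A : Adj n) {f k b c} →
                          Connected A → Connected B → Isometric B A f →
                          IsTruncMetDim A k b → IsTruncMetDim B k c → b ≤ c + (n ∸ m)
truncMetDim-≤-isometric B A connected-A connected-B iso (_ , minimal) ((S , resolving , refl) , _) =
  ≤-trans (minimal _ (extension-resolving connected-A iso resolving))
          (∣extension∣≤ (isometric-injective connected-B iso) S)

∣1+m-m∣≡1 : ∀ m → ∣ suc m - m ∣ ≡ 1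
∣1+m-m∣≡1 zero    = refl
∣1+m-m∣≡1 (suc m) = ∣1+m-m∣≡1 m

module _ (N : ℕ) where

  pathAdj-sym : Symmetric (pathAdj N)
  pathAdj-sym i j = ∨-comm (toℕ i ≡ᵇ suc (toℕ j)) _

  pathAdj⇒∣-∣≡1 : ∀ {i j} → T (pathAdj N i j) → ∣ toℕ i - toℕ j ∣ ≡ 1
  pathAdj⇒∣-∣≡1 {i} {j} ij with Equivalence.to T-∨ ij
  ... | inj₁ i≡1+j rewrite ≡ᵇ⇒≡ (toℕ i) _ i≡1+j = ∣1+m-m∣≡1 (toℕ j)
  ... | inj₂ j≡1+i rewrite ≡ᵇ⇒≡ (toℕ j) _ j≡1+i = trans (∣-∣-comm (toℕ i) _) (∣1+m-m∣≡1 (toℕ i))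

  path-walk-length : ∀ {i j l} → Walk (pathAdj N) i j l → ∣ toℕ i - toℕ j ∣ ≤ l
  path-walk-length {i} here = ≤-reflexive (∣n-n∣≡0 (toℕ i))
  path-walk-length {i} {j} (step {v = v} iv X) = begin
    ∣ toℕ i - toℕ j ∣                      ≤⟨ ∣-∣-triangle (toℕ i) (toℕ v) (toℕ j) ⟩
    ∣ toℕ i - toℕ v ∣ + ∣ toℕ v - toℕ j ∣  ≡⟨ cong (_+ ∣ toℕ v - toℕ j ∣) (pathAdj⇒∣-∣≡1 {i} {v} iv) ⟩
    suc ∣ toℕ v - toℕ j ∣                  ≤⟨ s≤s (path-walk-length X) ⟩
    suc _                                  ∎
    where open ≤-Reasoning

  path-ascending : ∀ d {i j : Fin N} → toℕ i + d ≡ toℕ j → Walk (pathAdj N) i j d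
  path-ascending zero    {i} i+0≡j =
    subst (λ j → Walk (pathAdj N) i j 0) (toℕ-injective (trans (sym (+-identityʳ _)) i+0≡j)) here
  path-ascending (suc d) {i} {j} i+d≡j =
    step i~next (path-ascending d (trans (cong (_+ d) (toℕ-fromℕ< 1+i<N)) (trans (sym (+-suc _ d)) i+d≡j)))
    where
    1+i<N : suc (toℕ i) < N
    1+i<N = ≤-<-trans (subst (suc (toℕ i) ≤_) i+d≡j (m<m+n (toℕ i) (s≤s z≤n))) (toℕ<n j)
    i~next : T (pathAdj N i (fromℕ< 1+i<N))
    i~next = Equivalence.from T-∨ (inj₂ (≡⇒≡ᵇ _ _ (toℕ-fromℕ< 1+i<N)))

  path-dist : ∀ i j → Dist (pathAdj N) i j ∣ toℕ i - toℕ j ∣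
  path-dist i j = walk , λ _ → path-walk-length
    where
    walk : Walk (pathAdj N) i j ∣ toℕ i - toℕ j ∣
    walk with ≤-total (toℕ i) (toℕ j)
    ... | inj₁ i≤j = subst (Walk _ i j) (sym (m≤n⇒∣m-n∣≡n∸m i≤j)) (path-ascending _ (m+[n∸m]≡n i≤j))
    ... | inj₂ j≤i = subst (Walk _ i j) (sym (m≤n⇒∣n-m∣≡n∸m j≤i))
                       (reverse (pathAdj N) pathAdj-sym (path-ascending _ (m+[n∸m]≡n j≤i)))

  path-connected : Connected (pathAdj N)
  path-connected i j = _ , proj₁ (path-dist i j)

geodesic-isometric : ∀ {n} (A : Adj n) → Symmetric A → ∀ {u w l} (D : Dist A u w l) →
                     Isometric (pathAdj (suc l)) A (λ i → vertexAt A (proj₁ D) (toℕ i))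
geodesic-isometric A sym-A D {i} {j} Dpath =
  subst (Dist A _ _) (dist-unique (pathAdj _) (path-dist _ i j) Dpath) (geodesic-dist A sym-A D i j)

lemma4 : (n : ℕ) (A : Adj n) → 1 ≤ n → Symmetric A → Loopless A → Connected A →
    (δ : ℕ) → Diameter A δ → (k : ℕ) → 1 ≤ k →
    (b bP : ℕ) → IsTruncMetDim A k b → IsTruncMetDim (pathAdj (suc δ)) k bP →
    b ≤ bP + (n ∸ suc δ)
lemma4 n A _ sym-A _ connected δ (_ , _ , _ , diametral) k _ b bP dimA dimPath =
  truncMetDim-≤-isometric (pathAdj (suc δ)) A connected (path-connected (suc δ))
    (geodesic-isometric A sym-A diametral) dimA dimPath
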